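{- For all $j\in\mathbb{N}_{ -1}$ and $m\in\mathbb{D}_j$: if $N=2M$ with $M\in\mathbb{N}$, then $|\mu^{N,\mathrm{sym}}_{j,m}|\le\frac12\left(|\mu^{M,\varphi}_{j,m}|+|\mu^{M,1-\varphi}_{j,m}|\right)$; if $N=2M+1$ with $M\in\mathbb{N}$, then $|\mu^{N,\mathrm{sym}}_{j,m}|\le\frac1{2M+1}\left((M+1)|\mu^{M+1,\varphi}_{j,m}|+M|\mu^{M,1-\varphi}_{j,m}|\right)$.
   Context: For $n\in\mathbb{N}_0$ with binary expansion $n=\sum_{i=0}^k n_i2^i$, $\varphi(n)=\sum_{i=0}^k n_i2^{ -i-1}$. For a sequence $(x_n)$ in $[0,1)$ the local discrepancy of its first $N$ points is $\frac1N\sum_{n=0}^{N-1}\mathbf{1}_{[0,t)}(x_n)-t$. Let $D^{\mathrm{sym}}_N$, $D^{\varphi}_N$, $D^{1-\varphi}_N$ be the local discrepancies of the first $N$ points of the symmetrized van der Corput sequence ($z_{2m}=\varphi(m)$, $z_{2m+1}=1-\varphi(m)$), of $(\varphi(n))_{n\ge0}$, and of $(1-\varphi(n))_{n\ge0}$, respectively. Let $\mathbb{N}_{ -1}=\mathbb{N}_0\cup\{ -1\}$, $\mathbb{D}_j=\{0,\dots,2^j-1\}$ for $j\ge0$, $\mathbb{D}_{ -1}=\{0\}$. Haar functions on $[0,1)$: $h_{ -1,0}=\mathbf{1}_{[0,1)}$, and for $j\ge0$, $m\in\mathbb{D}_j$, $h_{j,m}$ equals $+1$ on $[m2^{ -j},(2m+1)2^{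 -j-1})$, $-1$ on $[(2m+1)2^{ -j-1},(m+1)2^{ -j})$, and $0$ elsewhere. Then $\mu^{N,\mathrm{sym}}_{j,m}=\int_0^1D^{\mathrm{sym}}_N(t)h_{j,m}(t)\,dt$, and $\mu^{N,\varphi}_{j,m}$, $\mu^{N,1-\varphi}_{j,m}$ are defined analogously with $D^{\varphi}_N$, $D^{1-\varphi}_N$. -}

module Defs where

open import Data.Nat using (ℕ; zero; suc; _^_; ⌊_/2⌋; _%_) renaming (_+_ to _+ℕ_; _*_ to _*ℕ_)
open import Data.Integer using (+_)
open import Data.Maybe using (Maybe; just; nothing)
open import Data.Rational using (ℚ; _/_; 0ℚ; 1ℚ; ½; _+_; _*_; _-_; _⊔_)

-- a / b as a rational; convention a / 0 := 0 (never used with b = 0 below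
-- in any relevant way: the statement only uses N ≥ 1 and powers of 2).
frac : ℕ → ℕ → ℚ
frac a zero = 0ℚ
frac a (suc b) = + a / suc b

ℕ→ℚ : ℕ → ℚ
ℕ→ℚ n = frac n 1

-- van der Corput radical inverse φ(n) = Σ n_i 2^{-i-1}, computed digit by digit
-- with fuel (fuel n suffices, since ⌊n/2⌋ iterated n times reaches 0)
φ-fuel : ℕ → ℕ → ℚ
φ-fuel zero n = 0ℚ
φ-fuel (suc f) n = ½ * ℕ→ℚ (n % 2) + ½ * φ-fuel f ⌊ n /2⌋

φ : ℕ → ℚ
φ n = φ-fuel n n

one-minus-φ : ℕ → ℚ
one-minus-φ n = 1ℚ - φ n

zsym : ℕ → ℚ
zsym n with n % 2
... | zero = φ ⌊ n /2⌋
... | suc _ = 1ℚ - φ ⌊ n /2⌋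

sumTo : ℕ → (ℕ → ℚ) → ℚ
sumTo zero f = 0ℚ
sumTo (suc N) f = sumTo N f + f N

-- ∫_a^b 1_{[0,t)}(x) dt  (for a ≤ b) = Lebesgue measure of {t ∈ [a,b) : x < t}
--                                    = max(0, b - max(a, x))
∫ind : ℚ → ℚ → ℚ → ℚ
∫ind a b x = 0ℚ ⊔ (b - (a ⊔ x))

∫id : ℚ → ℚ → ℚ
∫id a b = ½ * (b * b - a * a)

-- ∫_a^b D_N(t) dt for the local discrepancy D_N(t) = (1/N) Σ_{n<N} 1_{[0,t)}(x_n) - t
∫D : (ℕ → ℚ) → ℕ → ℚ → ℚ → ℚ
∫D x N a b = frac 1 N * sumTo N (λ n → ∫ind a b (x n)) - ∫id a b

-- 𝔻_j : |𝔻_{-1}| = 1, |𝔻_j| = 2^j ; j ∈ ℕ_{-1} is encoded as Maybe ℕ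
-- (nothing = -1, just j = j)
card𝔻 : Maybe ℕ → ℕ
card𝔻 nothing = 1
card𝔻 (just j) = 2 ^ j

-- Haar coefficient μ^{N,x}_{j,m} = ∫_0^1 D_N(t) h_{j,m}(t) dt
μ : (ℕ → ℚ) → ℕ → Maybe ℕ → ℕ → ℚ
μ x N nothing m = ∫D x N 0ℚ 1ℚ
μ x N (just j) m =
  ∫D x N (frac m (2 ^ j)) (frac (2 *ℕ m +ℕ 1) (2 ^ suc j))
  - ∫D x N (frac (2 *ℕ m +ℕ 1) (2 ^ suc j)) (frac (suc m) (2 ^ j))

{-# OPTIONS --safe #-}

-- The first 2M points of the symmetrized sequence are, as a multiset, the first M
-- points of φ together with the first M points of 1 − φ; the first 2M + 1 points are
-- the first M + 1 points of φ together with the first M points of 1 − φ.  Since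
-- N · ∫ D_N is the counting sum minus N · ∫ t dt, every Haar coefficient satisfies
-- N μ^{N,sym} = A μ^{A,φ} + B μ^{B,1−φ} exactly (N = A + B), and both bounds are
-- the triangle inequality applied to this identity.
module Submission where

open import Defs
open import Data.Nat using (ℕ; suc; _<_; _≤_) renaming (_+_ to _+ℕ_; _*_ to _*ℕ_)
open import Data.Maybe using (Maybe)
open import Data.Product using (_×_)
open import Data.Rational using (½; _+_; _*_; ∣_∣) renaming (_≤_ to _≤ℚ_)

open import Level using (0ℓ)
open import Function using (_∘_)
open import Data.Nat using (zero; NonZero; ⌊_/2⌋; ⌈_/2⌉; _%_; _^_)
import Data.Nat.Properties as ℕ
open import Data.Nat.DivMod using (%-congˡ; m*n%n≡0; [m+kn]%n≡m%n)
open import Data.Integer as ℤ using (+_)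
import Data.Integer.Properties as ℤ
import Data.Integer.Tactic.RingSolver as ℤ
open import Data.Maybe using (just; nothing)
open import Data.Product using (_,_)
open import Data.Rational using (ℚ; 0ℚ; 1ℚ; _-_; NonNegative; toℚᵘ)
open import Data.Rational.Properties
import Data.Rational.Unnormalised as ℚᵘ
import Data.Rational.Unnormalised.Properties as ℚᵘ
open import Relation.Binary.PropositionalEquality
open import Tactic.RingSolver using (solve-∀)
import Tactic.RingSolver.Core.AlmostCommutativeRing as ACR

ℚ-ring : ACR.AlmostCommutativeRing 0ℓ 0ℓ
ℚ-ring = ACR.fromCommutativeRing +-*-commutativeRing (λ _ → nothing)

toℚᵘ-frac : ∀ a n .{{_ : NonZero n}} → toℚᵘ (frac a n) ℚᵘ.≃ + a ℚᵘ./ n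
toℚᵘ-frac a (suc b) = toℚᵘ-fromℚᵘ (+ a ℚᵘ./ suc b)

ℕ→ℚ-homo-+ : ∀ a b → ℕ→ℚ (a +ℕ b) ≡ ℕ→ℚ a + ℕ→ℚ b
ℕ→ℚ-homo-+ a b = toℚᵘ-injective (begin
  toℚᵘ (ℕ→ℚ (a +ℕ b))
    ≈⟨ toℚᵘ-frac (a +ℕ b) 1 ⟩
  + (a +ℕ b) ℚᵘ./ 1
    ≈⟨ ℚᵘ.*≡* (cong (ℤ._* + 1) (trans (ℤ.pos-+ a b) (unit-denominators (+ a) (+ b)))) ⟩
  + a ℚᵘ./ 1 ℚᵘ.+ + b ℚᵘ./ 1
    ≈⟨ ℚᵘ.+-cong (toℚᵘ-frac a 1) (toℚᵘ-frac b 1) ⟨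
  toℚᵘ (ℕ→ℚ a) ℚᵘ.+ toℚᵘ (ℕ→ℚ b)
    ≈⟨ toℚᵘ-homo-+ (ℕ→ℚ a) (ℕ→ℚ b) ⟨
  toℚᵘ (ℕ→ℚ a + ℕ→ℚ b) ∎)
  where
  open ℚᵘ.≃-Reasoning
  unit-denominators : ∀ p q → p ℤ.+ q ≡ p ℤ.* + 1 ℤ.+ q ℤ.* + 1
  unit-denominators = ℤ.solve-∀

frac-1-inverseˡ : ∀ n .{{_ : NonZero n}} → frac 1 n * ℕ→ℚ n ≡ 1ℚ
frac-1-inverseˡ n@(suc _) = toℚᵘ-injective (begin
  toℚᵘ (frac 1 n * ℕ→ℚ n)                 ≈⟨ toℚᵘ-homo-* (frac 1 n) (ℕ→ℚ n) ⟩
  -- + 1 ℚᵘ./ n and ℚᵘ.1/ (+ n ℚᵘ./ 1) are the same term up to computation.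
  toℚᵘ (frac 1 n) ℚᵘ.* toℚᵘ (ℕ→ℚ n)       ≈⟨ ℚᵘ.*-cong (toℚᵘ-frac 1 n) (toℚᵘ-frac n 1) ⟩
  ℚᵘ.1/ (+ n ℚᵘ./ 1) ℚᵘ.* (+ n ℚᵘ./ 1)    ≈⟨ ℚᵘ.*-inverseˡ (+ n ℚᵘ./ 1) ⟩
  ℚᵘ.1ℚᵘ                                  ∎)
  where open ℚᵘ.≃-Reasoning

frac-nonNeg : ∀ a n → NonNegative (frac a n)
frac-nonNeg a zero    = _
frac-nonNeg a (suc n) = normalize-nonNeg a (suc n)

n+n≡2*n : ∀ n → n +ℕ n ≡ 2 *ℕ n
n+n≡2*n n = cong (n +ℕ_) (sym (ℕ.+-identityʳ n))

sumTo-cong : ∀ N {f g : ℕ → ℚ} → (∀ n → f n ≡ g n) → sumTo N f ≡ sumTo N g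
sumTo-cong zero    f≗g = refl
sumTo-cong (suc N) f≗g = cong₂ _+_ (sumTo-cong N f≗g) (f≗g N)

sumTo-2* : ∀ M (g : ℕ → ℚ) →
  sumTo (2 *ℕ M) g ≡ sumTo M (g ∘ (2 *ℕ_)) + sumTo M (g ∘ suc ∘ (2 *ℕ_))
sumTo-2* zero    g = refl
sumTo-2* (suc M) g = begin
  sumTo (2 *ℕ suc M) g
    ≡⟨ cong (λ n → sumTo n g) (ℕ.*-suc 2 M) ⟩
  sumTo (2 *ℕ M) g + g (2 *ℕ M) + g (suc (2 *ℕ M))
    ≡⟨ cong (λ s → s + g (2 *ℕ M) + g (suc (2 *ℕ M))) (sumTo-2* M g) ⟩
  evens + odds + g (2 *ℕ M) + g (suc (2 *ℕ M))
    ≡⟨ interchange evens odds (g (2 *ℕ M)) (g (suc (2 *ℕ M))) ⟩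
  evens + g (2 *ℕ M) + (odds + g (suc (2 *ℕ M))) ∎
  where
  open ≡-Reasoning
  evens odds : ℚ
  evens = sumTo M (g ∘ (2 *ℕ_))
  odds  = sumTo M (g ∘ suc ∘ (2 *ℕ_))
  interchange : ∀ a b c d → a + b + c + d ≡ a + c + (b + d)
  interchange = solve-∀ ℚ-ring

sumTo-2*+1 : ∀ M (g : ℕ → ℚ) →
  sumTo (2 *ℕ M +ℕ 1) g ≡ sumTo (suc M) (g ∘ (2 *ℕ_)) + sumTo M (g ∘ suc ∘ (2 *ℕ_))
sumTo-2*+1 M g = begin
  sumTo (2 *ℕ M +ℕ 1) g
    ≡⟨ cong (λ n → sumTo n g) (ℕ.+-comm (2 *ℕ M) 1) ⟩
  sumTo (2 *ℕ M) g + g (2 *ℕ M)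
    ≡⟨ cong (_+ g (2 *ℕ M)) (sumTo-2* M g) ⟩
  evens + odds + g (2 *ℕ M)
    ≡⟨ swap evens odds (g (2 *ℕ M)) ⟩
  evens + g (2 *ℕ M) + odds ∎
  where
  open ≡-Reasoning
  evens odds : ℚ
  evens = sumTo M (g ∘ (2 *ℕ_))
  odds  = sumTo M (g ∘ suc ∘ (2 *ℕ_))
  swap : ∀ a b c → a + b + c ≡ a + c + b
  swap = solve-∀ ℚ-ring

zsym-of-even : ∀ n → n % 2 ≡ 0 → zsym n ≡ φ ⌊ n /2⌋
zsym-of-even n n%2≡0 with n % 2
... | zero = refl
zsym-of-even n () | suc _

zsym-of-odd : ∀ n → n % 2 ≡ 1 → zsym n ≡ one-minus-φ ⌊ n /2⌋
zsym-of-odd n n%2≡1 with n % 2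
zsym-of-odd n () | zero
... | suc _ = refl

⌊2*n/2⌋≡n : ∀ n → ⌊ 2 *ℕ n /2⌋ ≡ n
⌊2*n/2⌋≡n n = sym (trans (ℕ.n≡⌊n+n/2⌋ n) (cong ⌊_/2⌋ (n+n≡2*n n)))

⌊1+2*n/2⌋≡n : ∀ n → ⌊ suc (2 *ℕ n) /2⌋ ≡ n
⌊1+2*n/2⌋≡n n = sym (trans (ℕ.n≡⌈n+n/2⌉ n) (cong ⌈_/2⌉ (n+n≡2*n n)))

zsym-2* : ∀ k → zsym (2 *ℕ k) ≡ φ k
zsym-2* k = trans (zsym-of-even (2 *ℕ k) 2k%2≡0) (cong φ (⌊2*n/2⌋≡n k))
  where
  2k%2≡0 : 2 *ℕ k % 2 ≡ 0
  2k%2≡0 = trans (%-congˡ (ℕ.*-comm 2 k)) (m*n%n≡0 k 2)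

zsym-1+2* : ∀ k → zsym (suc (2 *ℕ k)) ≡ one-minus-φ k
zsym-1+2* k = trans (zsym-of-odd (suc (2 *ℕ k)) [1+2k]%2≡1) (cong one-minus-φ (⌊1+2*n/2⌋≡n k))
  where
  [1+2k]%2≡1 : suc (2 *ℕ k) % 2 ≡ 1
  [1+2k]%2≡1 = trans (%-congˡ {o = 2} (cong suc (ℕ.*-comm 2 k))) ([m+kn]%n≡m%n 1 k 2)

record Merges (z : ℕ → ℚ) (N : ℕ) (x : ℕ → ℚ) (A : ℕ) (y : ℕ → ℚ) (B : ℕ) : Set where
  field
    length-+    : A +ℕ B ≡ N
    sumTo-merge : ∀ (h : ℚ → ℚ) → sumTo N (h ∘ z) ≡ sumTo A (h ∘ x) + sumTo B (h ∘ y)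

zsym-merges-2* : ∀ M → Merges zsym (2 *ℕ M) φ M one-minus-φ M
zsym-merges-2* M = record
  { length-+    = n+n≡2*n M
  ; sumTo-merge = λ h → trans (sumTo-2* M (h ∘ zsym))
      (cong₂ _+_ (sumTo-cong M (cong h ∘ zsym-2*)) (sumTo-cong M (cong h ∘ zsym-1+2*)))
  }

zsym-merges-2*+1 : ∀ M → Merges zsym (2 *ℕ M +ℕ 1) φ (suc M) one-minus-φ M
zsym-merges-2*+1 M = record
  { length-+    = trans (cong suc (n+n≡2*n M)) (ℕ.+-comm 1 (2 *ℕ M))
  ; sumTo-merge = λ h → trans (sumTo-2*+1 M (h ∘ zsym))
      (cong₂ _+_ (sumTo-cong (suc M) (cong h ∘ zsym-2*)) (sumTo-cong M (cong h ∘ zsym-1+2*)))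
  }

ℕ→ℚ-*-∫D : ∀ x N a b → ℕ→ℚ N * ∫D x N a b ≡ sumTo N (∫ind a b ∘ x) - ℕ→ℚ N * ∫id a b
ℕ→ℚ-*-∫D x zero    a b = empty (∫id a b)
  where
  empty : ∀ I → 0ℚ * (0ℚ * 0ℚ - I) ≡ 0ℚ - 0ℚ * I
  empty = solve-∀ ℚ-ring
ℕ→ℚ-*-∫D x N@(suc _) a b = begin
  ℕ→ℚ N * (frac 1 N * S - I)         ≡⟨ expand (ℕ→ℚ N) (frac 1 N) S I ⟩
  (frac 1 N * ℕ→ℚ N) * S - ℕ→ℚ N * I ≡⟨ cong (λ c → c * S - ℕ→ℚ N * I) (frac-1-inverseˡ N) ⟩
  1ℚ * S - ℕ→ℚ N * I                 ≡⟨ cong (_- ℕ→ℚ N * I) (*-identityˡ S) ⟩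
  S - ℕ→ℚ N * I                      ∎
  where
  open ≡-Reasoning
  S I : ℚ
  S = sumTo N (∫ind a b ∘ x)
  I = ∫id a b
  expand : ∀ n r S I → n * (r * S - I) ≡ (r * n) * S - n * I
  expand = solve-∀ ℚ-ring

∫D-merge : ∀ {z N x A y B} → Merges z N x A y B → ∀ a b →
  ℕ→ℚ N * ∫D z N a b ≡ ℕ→ℚ A * ∫D x A a b + ℕ→ℚ B * ∫D y B a b
∫D-merge {z} {_} {x} {A} {y} {B} record { length-+ = refl ; sumTo-merge = merge } a b = begin
  ℕ→ℚ (A +ℕ B) * ∫D z (A +ℕ B) a b
    ≡⟨ ℕ→ℚ-*-∫D z (A +ℕ B) a b ⟩
  sumTo (A +ℕ B) (∫ind a b ∘ z) - ℕ→ℚ (A +ℕ B) * I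
    ≡⟨ cong₂ (λ S n → S - n * I) (merge (∫ind a b)) (ℕ→ℚ-homo-+ A B) ⟩
  (Sx + Sy) - (ℕ→ℚ A + ℕ→ℚ B) * I
    ≡⟨ regroup Sx Sy (ℕ→ℚ A) (ℕ→ℚ B) I ⟩
  (Sx - ℕ→ℚ A * I) + (Sy - ℕ→ℚ B * I)
    ≡⟨ cong₂ _+_ (ℕ→ℚ-*-∫D x A a b) (ℕ→ℚ-*-∫D y B a b) ⟨
  ℕ→ℚ A * ∫D x A a b + ℕ→ℚ B * ∫D y B a b ∎
  where
  open ≡-Reasoning
  Sx Sy I : ℚ
  Sx = sumTo A (∫ind a b ∘ x)
  Sy = sumTo B (∫ind a b ∘ y)
  I  = ∫id a b
  regroup : ∀ Sx Sy p q I → (Sx + Sy) - (p + q) * I ≡ (Sx - p * I) + (Sy - q * I)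
  regroup = solve-∀ ℚ-ring

μ-merge : ∀ {z N x A y B} → Merges z N x A y B → ∀ j m →
  ℕ→ℚ N * μ z N j m ≡ ℕ→ℚ A * μ x A j m + ℕ→ℚ B * μ y B j m
μ-merge merge nothing m = ∫D-merge merge 0ℚ 1ℚ
μ-merge {z} {N} {x} {A} {y} {B} merge (just j) m = begin
  ℕ→ℚ N * (∫D z N l c - ∫D z N c r)
    ≡⟨ *-distribˡ-- (ℕ→ℚ N) (∫D z N l c) (∫D z N c r) ⟩
  ℕ→ℚ N * ∫D z N l c - ℕ→ℚ N * ∫D z N c r
    ≡⟨ cong₂ _-_ (∫D-merge merge l c) (∫D-merge merge c r) ⟩
  (ℕ→ℚ A * ∫D x A l c + ℕ→ℚ B * ∫D y B l c) - (ℕ→ℚ A * ∫D x A c r + ℕ→ℚ B * ∫D y B c r)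
    ≡⟨ regroup (ℕ→ℚ A) (ℕ→ℚ B) (∫D x A l c) (∫D y B l c) (∫D x A c r) (∫D y B c r) ⟩
  ℕ→ℚ A * (∫D x A l c - ∫D x A c r) + ℕ→ℚ B * (∫D y B l c - ∫D y B c r) ∎
  where
  open ≡-Reasoning
  l c r : ℚ
  l = frac m (2 ^ j)
  c = frac (2 *ℕ m +ℕ 1) (2 ^ suc j)
  r = frac (suc m) (2 ^ j)
  *-distribˡ-- : ∀ n p q → n * (p - q) ≡ n * p - n * q
  *-distribˡ-- = solve-∀ ℚ-ring
  regroup : ∀ p q a b a′ b′ → (p * a + q * b) - (p * a′ + q * b′) ≡ p * (a - a′) + q * (b - b′)
  regroup = solve-∀ ℚ-ring

∣nonNeg∣≡ : ∀ p .{{_ : NonNegative p}} → ∣ p ∣ ≡ p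
∣nonNeg∣≡ p = 0≤p⇒∣p∣≡p (nonNegative⁻¹ p)

∣weighted-sum∣≤ : ∀ w p q a b .{{_ : NonNegative w}} .{{_ : NonNegative p}} .{{_ : NonNegative q}} →
  ∣ w * (p * a + q * b) ∣ ≤ℚ w * (p * ∣ a ∣ + q * ∣ b ∣)
∣weighted-sum∣≤ w p q a b = begin
  ∣ w * (p * a + q * b) ∣        ≡⟨ trans (∣p*q∣≡∣p∣*∣q∣ w _) (cong (_* ∣ p * a + q * b ∣) (∣nonNeg∣≡ w)) ⟩
  w * ∣ p * a + q * b ∣          ≤⟨ *-monoˡ-≤-nonNeg w (∣p+q∣≤∣p∣+∣q∣ (p * a) (q * b)) ⟩
  w * (∣ p * a ∣ + ∣ q * b ∣)    ≡⟨ cong (w *_) (cong₂ _+_ (∣nonNeg*∣ p a) (∣nonNeg*∣ q b)) ⟩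
  w * (p * ∣ a ∣ + q * ∣ b ∣)    ∎
  where
  open ≤-Reasoning
  ∣nonNeg*∣ : ∀ p a .{{_ : NonNegative p}} → ∣ p * a ∣ ≡ p * ∣ a ∣
  ∣nonNeg*∣ p a = trans (∣p*q∣≡∣p∣*∣q∣ p a) (cong (_* ∣ a ∣) (∣nonNeg∣≡ p))

∣μ∣-merge-bound : ∀ {z N x A y B} → Merges z N x A y B → .{{_ : NonZero N}} → ∀ j m →
  ∣ μ z N j m ∣ ≤ℚ frac 1 N * (ℕ→ℚ A * ∣ μ x A j m ∣ + ℕ→ℚ B * ∣ μ y B j m ∣)
∣μ∣-merge-bound {z} {N} {x} {A} {y} {B} merge j m = begin
  ∣ μ z N j m ∣
    ≡⟨ cong ∣_∣ (trans (sym (*-identityˡ _)) (cong (_* μ z N j m) (sym (frac-1-inverseˡ N)))) ⟩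
  ∣ (frac 1 N * ℕ→ℚ N) * μ z N j m ∣
    ≡⟨ cong ∣_∣ (trans (*-assoc (frac 1 N) (ℕ→ℚ N) _) (cong (frac 1 N *_) (μ-merge merge j m))) ⟩
  ∣ frac 1 N * (ℕ→ℚ A * μ x A j m + ℕ→ℚ B * μ y B j m) ∣
    ≤⟨ ∣weighted-sum∣≤ (frac 1 N) (ℕ→ℚ A) (ℕ→ℚ B) (μ x A j m) (μ y B j m)
         {{frac-nonNeg 1 N}} {{frac-nonNeg A 1}} {{frac-nonNeg B 1}} ⟩
  frac 1 N * (ℕ→ℚ A * ∣ μ x A j m ∣ + ℕ→ℚ B * ∣ μ y B j m ∣) ∎
  where open ≤-Reasoning

frac-1-[2*n]*n≡½ : ∀ n .{{_ : NonZero n}} → frac 1 (2 *ℕ n) * ℕ→ℚ n ≡ ½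
frac-1-[2*n]*n≡½ n@(suc _) = begin
  w * ℕ→ℚ n                   ≡⟨ halve w (ℕ→ℚ n) ⟩
  ½ * (w * (ℕ→ℚ n + ℕ→ℚ n))   ≡⟨ cong (λ k → ½ * (w * k)) (trans (sym (ℕ→ℚ-homo-+ n n)) (cong ℕ→ℚ (n+n≡2*n n))) ⟩
  ½ * (w * ℕ→ℚ (2 *ℕ n))      ≡⟨ cong (½ *_) (frac-1-inverseˡ (2 *ℕ n)) ⟩
  ½ * 1ℚ                      ∎
  where
  open ≡-Reasoning
  w : ℚ
  w = frac 1 (2 *ℕ n)
  halve : ∀ w k → w * k ≡ ½ * (w * (k + k))
  halve = solve-∀ ℚ-ring

corollary1 : (j : Maybe ℕ) (m : ℕ) → m < card𝔻 j → (M : ℕ) → 1 ≤ M →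
    (∣ μ zsym (2 *ℕ M) j m ∣ ≤ℚ ½ * (∣ μ φ M j m ∣ + ∣ μ one-minus-φ M j m ∣))
    × (∣ μ zsym (2 *ℕ M +ℕ 1) j m ∣ ≤ℚ
         frac 1 (2 *ℕ M +ℕ 1) * (ℕ→ℚ (suc M) * ∣ μ φ (suc M) j m ∣ + ℕ→ℚ M * ∣ μ one-minus-φ M j m ∣))
-- The identity behind both bounds holds for every m.
corollary1 j m _ zero ()
corollary1 j m _ M@(suc _) _ = even , ∣μ∣-merge-bound (zsym-merges-2*+1 M) j m
  where
  open ≤-Reasoning
  a b w : ℚ
  a = ∣ μ φ M j m ∣
  b = ∣ μ one-minus-φ M j m ∣
  w = frac 1 (2 *ℕ M)
  factor : ∀ w n a b → w * (n * a + n * b) ≡ (w * n) * (a + b)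
  factor = solve-∀ ℚ-ring
  even : ∣ μ zsym (2 *ℕ M) j m ∣ ≤ℚ ½ * (a + b)
  even = begin
    ∣ μ zsym (2 *ℕ M) j m ∣         ≤⟨ ∣μ∣-merge-bound (zsym-merges-2* M) j m ⟩
    w * (ℕ→ℚ M * a + ℕ→ℚ M * b)     ≡⟨ factor w (ℕ→ℚ M) a b ⟩
    (w * ℕ→ℚ M) * (a + b)           ≡⟨ cong (_* (a + b)) (frac-1-[2*n]*n≡½ M) ⟩
    ½ * (a + b)                     ∎
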